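{- There exist a group $X$ with a rotary pair $(a,z)$ and a group $Y$ with a rotary pair $(a',z')$, for which the constructions below are defined, such that the maps $\mathrm{RotaMap}(X,a,z)$ and $\mathrm{BiRoMap}(Y,a',z')$ are the same map (isomorphic as maps).
   Context: A rotary pair for a group $G$ is an ordered pair $(a,z)$ with $G=\langle a,z\rangle$, $|a|$ finite, $|z|=2$, $z\notin\langle a\rangle$; $x^g=g^{ -1}xg$. Maps: a map is a 2-cell embedding of a connected locally finite graph (vertices $V$, edges $E$; each edge incident with two distinct vertices, multiple edges allowed) in a connected compact surface without boundary; the faces are the open discs of the complement, each with a boundary cycle (a sequence class, i.e. up to cyclic shift and reversal, of edges around it). An isomorphism of maps is a bijection of vertices, edges and faces preserving types, incidences and boundary cycles. $\mathrm{RotaMap}(G,a,z)$ (defined for a rotary pair with $|a|\ge 3$, $\langle a\rangle\ne\langle a\rangle^z$, $m=|az|$ finite): vertices $[G:\langle a\rangle]$, edges $[G:\langle z\rangle]$, faces $[G:\langle az\rangle]$ (right cosets), incidence given by non-empty intersection; the face $\langle az\rangle g$ has boundary cycle $C(az)g$ with $C(az)=(e_0,\dots,e_{m-1})$, $e_i=\langle z\rangle(az)^i$; the surface is obtained by gluing discs bounded by these cycles along common edges. $\mathrm{BiRoMap}(G,a,z)$ (defined for a rotary pair with $|a|\ge3$, $\langle a\rangle\ne\langle a\rangle^z$, $\ell=|zz^a|$ finite): vertices $[G:\langle a\rangle]$, edges $[G:\langle z\rangle]$, vertex–edge incidence by non-empty intersection; faces are the edge sequences $C(W)g$, $g\in G$,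 with $C(W)=(e'_0,\dots,e'_{2\ell-1})$, $e'_{2i}=\langle z\rangle (zz^a)^i$, $e'_{2i+1}=\langle z\rangle a(zz^a)^i$; edges/vertices on the sequence are incident with the face; the surface is obtained by gluing discs bounded by these cycles along common edges. -}

module Defs where

open import Level using (0ℓ)
open import Algebra.Bundles using (Group)
open import Data.Nat using (ℕ; zero; suc; _≤_; _<_)
open import Data.Integer using (ℤ; +_; -[1+_])
open import Data.Product using (Σ; _×_; _,_; ∃)
open import Data.Sum using (_⊎_)
open import Data.List using (List; []; _∷_; _++_; map; drop; take; reverse; upTo; concatMap)
open import Data.List.Relation.Binary.Pointwise using (Pointwise)
open import Data.List.Relation.Unary.Any using (Any)
open import Relation.Nullary using (¬_)

module GroupNotions (G : Group 0ℓ 0ℓ) where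
  open Group G

  pow : Carrier → ℕ → Carrier
  pow x zero    = ε
  pow x (suc n) = x ∙ pow x n

  zpow : Carrier → ℤ → Carrier
  zpow x (+ n)      = pow x n
  zpow x -[1+ n ]   = pow (x ⁻¹) (suc n)

  InCyc : Carrier → Carrier → Set
  InCyc x g = Σ ℤ λ k → g ≈ zpow x k

  InConj : Carrier → Carrier → Carrier → Set
  InConj x y g = Σ ℤ λ k → g ≈ ((y ⁻¹ ∙ zpow x k) ∙ y)

  IsOrder : Carrier → ℕ → Set
  IsOrder x n = (1 ≤ n) × (pow x n ≈ ε) × (∀ k → 1 ≤ k → k < n → ¬ (pow x k ≈ ε))

  FiniteOrder : Carrier → Set
  FiniteOrder x = Σ ℕ λ n → IsOrder x n

  data Gen (a z : Carrier) : Carrier → Set where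
    gen-ε   : Gen a z ε
    gen-a   : ∀ {g} → Gen a z g → Gen a z (g ∙ a)
    gen-a⁻¹ : ∀ {g} → Gen a z g → Gen a z (g ∙ a ⁻¹)
    gen-z   : ∀ {g} → Gen a z g → Gen a z (g ∙ z)
    gen-z⁻¹ : ∀ {g} → Gen a z g → Gen a z (g ∙ z ⁻¹)
    gen-≈   : ∀ {g h} → g ≈ h → Gen a z g → Gen a z h

  record RotaryPair (a z : Carrier) : Set where
    field
      generates : ∀ g → Gen a z g
      a-finite  : FiniteOrder a
      z-order2  : IsOrder z 2
      z∉⟨a⟩     : ¬ InCyc a z

  CyclicNotNormalisedBy : Carrier → Carrier → Set
  CyclicNotNormalisedBy a z =
    ¬ (∀ g → (InCyc a g → InConj a z g) × (InConj a z g → InCyc a g))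

  -- right cosets ⟨x⟩g, represented by g:  ⟨x⟩g = ⟨x⟩h  iff  g h⁻¹ ∈ ⟨x⟩
  CosetEq : Carrier → Carrier → Carrier → Set
  CosetEq x g h = InCyc x (g ∙ h ⁻¹)

  Meet : Carrier → Carrier → Carrier → Carrier → Set
  Meet x g y h = Σ Carrier λ k → InCyc x (k ∙ g ⁻¹) × InCyc y (k ∙ h ⁻¹)

  conj : Carrier → Carrier → Carrier
  conj x g = (g ⁻¹ ∙ x) ∙ g

rotate : {A : Set} → ℕ → List A → List A
rotate k xs = drop k xs ++ take k xs

SeqEquiv : {A : Set} → (A → A → Set) → List A → List A → Set
SeqEquiv R xs ys =
  Σ ℕ λ k → Pointwise R (rotate k xs) ys ⊎ Pointwise R (rotate k (reverse xs)) ys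

-- Combinatorial data of a map: vertices, edges, faces (each given by
-- representatives and an equality relation), incidences and boundary
-- cycles of faces.

record MapData : Set₁ where
  field
    V E F : Set
    _≈V_  : V → V → Set
    _≈E_  : E → E → Set
    _≈F_  : F → F → Set
    IVE   : V → E → Set
    IVF   : V → F → Set
    IEF   : E → F → Set
    bnd   : F → List E

_⇔_ : Set → Set → Set
P ⇔ Q = (P → Q) × (Q → P)

record Bij {A B : Set} (_≈A_ : A → A → Set) (_≈B_ : B → B → Set) (f : A → B) : Set where
  field
    resp : ∀ {x y} → x ≈A y → f x ≈B f y
    inj  : ∀ {x y} → f x ≈B f y → x ≈A y
    surj : ∀ y → Σ A λ x → f x ≈B y

record MapIso (M N : MapData) : Set where
  private
    module M = MapData M
    module N = MapData N
  field
    fV : M.V → N.V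
    fE : M.E → N.E
    fF : M.F → N.F
    bijV : Bij M._≈V_ N._≈V_ fV
    bijE : Bij M._≈E_ N._≈E_ fE
    bijF : Bij M._≈F_ N._≈F_ fF
    presVE : ∀ v e → M.IVE v e ⇔ N.IVE (fV v) (fE e)
    presVF : ∀ v f → M.IVF v f ⇔ N.IVF (fV v) (fF f)
    presEF : ∀ e f → M.IEF e f ⇔ N.IEF (fE e) (fF f)
    presBnd : ∀ f → SeqEquiv N._≈E_ (map fE (M.bnd f)) (N.bnd (fF f))

record RotaInput : Set₁ where
  field
    X  : Group 0ℓ 0ℓ
  open Group X using (Carrier; _∙_)
  open GroupNotions X
  field
    a z    : Carrier
    rotary : RotaryPair a z
    ordA   : ℕ
    isOrdA : IsOrder a ordA
    ordA≥3 : 3 ≤ ordA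
    notNorm : CyclicNotNormalisedBy a z
    m      : ℕ
    isOrdAZ : IsOrder (a ∙ z) m

record BiRoInput : Set₁ where
  field
    Y  : Group 0ℓ 0ℓ
  open Group Y using (Carrier; _∙_)
  open GroupNotions Y
  field
    a z    : Carrier
    rotary : RotaryPair a z
    ordA   : ℕ
    isOrdA : IsOrder a ordA
    ordA≥3 : 3 ≤ ordA
    notNorm : CyclicNotNormalisedBy a z
    ℓ      : ℕ
    isOrdW : IsOrder (z ∙ conj z a) ℓ

RotaMap : RotaInput → MapData
RotaMap I = record
  { V = Carrier ; E = Carrier ; F = Carrier
  ; _≈V_ = CosetEq a ; _≈E_ = CosetEq z ; _≈F_ = CosetEq (a ∙ z)
  ; IVE = λ v e → Meet a v z e
  ; IVF = λ v f → Meet a v (a ∙ z) f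
  ; IEF = λ e f → Meet z e (a ∙ z) f
  ; bnd = λ g → map (λ i → pow (a ∙ z) i ∙ g) (upTo m)
  }
  where
  open RotaInput I
  open Group X
  open GroupNotions X

BiRoMap : BiRoInput → MapData
BiRoMap I = record
  { V = Carrier ; E = Carrier ; F = Carrier
  ; _≈V_ = CosetEq a ; _≈E_ = CosetEq z
  ; _≈F_ = λ g h → SeqEquiv (CosetEq z) (cyc g) (cyc h)
  ; IVE = λ v e → Meet a v z e
  ; IVF = λ v g → Any (λ e → Meet a v z e) (cyc g)
  ; IEF = λ e g → Any (CosetEq z e) (cyc g)
  ; bnd = cyc
  }
  where
  open BiRoInput I
  open Group Y
  open GroupNotions Y
  w : Carrier
  w = z ∙ conj z a
  cyc : Carrier → List Carrier
  cyc g = concatMap (λ i → (pow w i ∙ g) ∷ ((a ∙ pow w i) ∙ g) ∷ []) (upTo ℓ)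

-- Both maps live in the wreath product G = ℤ₃ ≀ C₂ with a = (1, 0) and z the
-- coordinate swap, so |a| = 3 and |az| = 6. Each edge class ⟨z⟩g contains a
-- unique element (u, v, false), which identifies the edges of both maps with
-- ℤ₃²; the vertices are the three rows v = c and the three columns u = c, so
-- both underlying graphs are K₃,₃. A face of RotaMap(G, a, z) is a zigzag
-- of the edges with u − v ∈ {d − 1, d}, a face of BiRoMap(G, a, z) one of
-- the edges with u + v ∈ {c, c + 1}. Hence (u, v) ↦ (u, −v) is an
-- isomorphism of the two hexagonal maps on the torus; everything that
-- remains is a finite check in a group of order 18.
module Submission where

open import Level using (0ℓ)
open import Algebra.Bundles using (Group)
open import Data.Bool using (Bool; true; false; not)
import Data.Bool.Properties as Bool
open import Data.Fin using (Fin; toℕ; #_)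
import Data.Fin.Properties as Fin
open import Data.Integer using (+_; -[1+_])
open import Data.List using (List; []; _∷_; _++_; length; reverse; map; allFin; cartesianProduct)
open import Data.List.Membership.Propositional using (_∈_; lose)
open import Data.List.Membership.Propositional.Properties using (∈-allFin; ∈-cartesianProduct⁺)
open import Data.List.Properties using (drop-all; take-all; length-reverse; ++-identityʳ)
open import Data.List.Relation.Binary.Pointwise using (Pointwise)
import Data.List.Relation.Binary.Pointwise.Properties as Pointwise
open import Data.List.Relation.Unary.All as All using ()
open import Data.List.Relation.Unary.Any as Any using (here; there)
open import Data.Nat using (ℕ; zero; suc; _+_; _∸_; _≤_; _<_; s≤s; z≤n; _≤?_)
open import Data.Nat.DivMod using (_mod_)
open import Data.Nat.Properties using (≰⇒≥; ≤-refl; anyUpTo?; allUpTo?)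
open import Data.Product using (Σ; _×_; _,_; proj₂)
open import Data.Product.Properties using (≡-dec)
open import Data.Sum as Sum using (_⊎_)
open import Relation.Binary using (Decidable; DecidableEquality)
open import Relation.Binary.PropositionalEquality
  using (_≡_; refl; sym; trans; cong; cong₂; subst; isEquivalence)
open import Relation.Nullary using (Dec; yes; no; ¬_)
open import Relation.Nullary.Decidable
  using (map′; from-yes; from-no; _×-dec_; _⊎-dec_; _→-dec_; ¬?)

open import Defs

_⇔?_ : {P Q : Set} → Dec P → Dec Q → Dec (P ⇔ Q)
p? ⇔? q? = (p? →-dec q?) ×-dec (q? →-dec p?)

module Exhaustive {A : Set} (elements : List A) (complete : ∀ x → x ∈ elements) where

  ∀? : {P : A → Set} → (∀ x → Dec (P x)) → Dec (∀ x → P x)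
  ∀? P? = map′ (λ all x → All.lookup all (complete x))
               (λ all → All.tabulate λ {x} _ → all x)
               (All.all? P? elements)

  ∃? : {P : A → Set} → (∀ x → Dec (P x)) → Dec (Σ A P)
  ∃? P? = map′ Any.satisfied (λ (x , px) → lose (complete x) px) (Any.any? P? elements)

  bij? : {R S : A → A → Set} → Decidable R → Decidable S → (f : A → A) → Dec (Bij R S f)
  bij? R? S? f =
    map′ (λ (resp , inj , surj) → record { resp = resp _ _ ; inj = inj _ _ ; surj = surj })
         (λ b → (λ _ _ → Bij.resp b) , (λ _ _ → Bij.inj b) , Bij.surj b)
         ((∀? λ x → ∀? λ y → R? x y →-dec S? (f x) (f y)) ×-dec
          (∀? λ x → ∀? λ y → S? (f x) (f y) →-dec R? x y) ×-dec
          (∀? λ y → ∃? λ x → S? (f x) y))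

module _ (𝔾 : Group 0ℓ 0ℓ) where
  open Group 𝔾 using (Carrier; _≈_; _∙_; ε; _⁻¹; assoc; identityʳ; ∙-congˡ; ∙-congʳ) renaming (sym to ≈-sym)
  open GroupNotions 𝔾

  pow-closure : ∀ {y} (P : Carrier → Set) → P ε → (∀ {g} → P g → P (y ∙ g)) → ∀ n → P (pow y n)
  pow-closure P Pε Py zero    = Pε
  pow-closure P Pε Py (suc n) = Py (pow-closure P Pε Py n)

  InCyc-closure : ∀ {x} (P : Carrier → Set) → (∀ {g h} → g ≈ h → P g → P h) →
                  P ε → (∀ {g} → P g → P (x ∙ g)) → (∀ {g} → P g → P (x ⁻¹ ∙ g)) →
                  ∀ {g} → InCyc x g → P g
  InCyc-closure P resp Pε Px Px⁻¹ (+ n , g≈xⁿ) =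
    resp (≈-sym g≈xⁿ) (pow-closure P Pε Px n)
  InCyc-closure P resp Pε Px Px⁻¹ (-[1+ n ] , g≈x⁻ⁿ) =
    resp (≈-sym g≈x⁻ⁿ) (pow-closure P Pε Px⁻¹ (suc n))

  Gen-∙pow : ∀ {a z g} n → Gen a z g → Gen a z (g ∙ pow a n)
  Gen-∙pow zero    gen = gen-≈ (≈-sym (identityʳ _)) gen
  Gen-∙pow (suc n) gen = gen-≈ (assoc _ _ _) (Gen-∙pow n (gen-a gen))

  conj∉⟨a⟩⇒notNormalised : ∀ {a z} → ¬ InCyc a (conj a z) → CyclicNotNormalisedBy a z
  conj∉⟨a⟩⇒notNormalised {a} {z} aᶻ∉⟨a⟩ normalised =
    aᶻ∉⟨a⟩ (proj₂ (normalised (conj a z)) (+ 1 , ∙-congʳ (∙-congˡ (≈-sym (identityʳ a)))))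

  IsOrder? : Decidable _≈_ → ∀ x n → Dec (IsOrder x n)
  IsOrder? _≈?_ x n = (1 ≤? n) ×-dec (pow x n ≈? ε) ×-dec no-smaller-power?
    where
    no-smaller-power? : Dec (∀ k → 1 ≤ k → k < n → ¬ pow x k ≈ ε)
    no-smaller-power? =
      map′ (λ below k 1≤k k<n → below k<n 1≤k) (λ below {k} k<n 1≤k → below k 1≤k k<n)
           (allUpTo? (λ k → (1 ≤? k) →-dec ¬? (pow x k ≈? ε)) n)

rotate-beyond-length : {A : Set} (k : ℕ) (xs : List A) → length xs ≤ k → rotate k xs ≡ rotate 0 xs
rotate-beyond-length k xs len≤k =
  trans (cong₂ _++_ (drop-all k xs len≤k) (take-all k xs len≤k)) (sym (++-identityʳ xs))

module _ {A : Set} {R : A → A → Set} (R? : Decidable R) where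

  private
    RotationMatches : List A → List A → ℕ → Set
    RotationMatches xs ys k =
      Pointwise R (rotate k xs) ys ⊎ Pointwise R (rotate k (reverse xs)) ys

    bounded-rotation : ∀ {xs ys} k → RotationMatches xs ys k →
             Σ ℕ λ j → j < suc (length xs) × RotationMatches xs ys j
    bounded-rotation {xs} {ys} k match with k ≤? length xs
    ... | yes k≤len = k , s≤s k≤len , match
    ... | no k≰len  = 0 , s≤s z≤n , Sum.map (subst Matches (rotate-beyond-length k xs len≤k))
                                            (subst Matches (rotate-beyond-length k (reverse xs) rev-len≤k))
                                            match
      where
      len≤k : length xs ≤ k
      len≤k = ≰⇒≥ k≰len
      rev-len≤k : length (reverse xs) ≤ k
      rev-len≤k = subst (_≤ k) (sym (length-reverse xs)) len≤k
      Matches : List A → Set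
      Matches l = Pointwise R l ys

  SeqEquiv? : ∀ xs ys → Dec (SeqEquiv R xs ys)
  SeqEquiv? xs ys =
    map′ (λ (k , _ , match) → k , match) (λ (k , match) → bounded-rotation k match)
         (anyUpTo? (λ k → Pointwise.decidable R? _ _ ⊎-dec Pointwise.decidable R? _ _) (suc (length xs)))

ℤ₃ : Set
ℤ₃ = Fin 3

infixl 6 _+₃_
infix 8 -₃_

_+₃_ : ℤ₃ → ℤ₃ → ℤ₃
x +₃ y = (toℕ x + toℕ y) mod 3

-₃_ : ℤ₃ → ℤ₃
-₃ x = (3 ∸ toℕ x) mod 3

-- ℤ₃ ≀ C₂ = ℤ₃² ⋊ C₂, where the generator s = true of C₂ swaps the two
-- coordinates.
G : Set
G = ℤ₃ × ℤ₃ × Bool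

_·_ : G → G → G
(x , y , false) · (u , v , t) = x +₃ u , y +₃ v , t
(x , y , true)  · (u , v , t) = x +₃ v , y +₃ u , not t

inv : G → G
inv (x , y , false) = -₃ x , -₃ y , false
inv (x , y , true)  = -₃ y , -₃ x , true

_≟_ : DecidableEquality G
_≟_ = ≡-dec Fin._≟_ (≡-dec Fin._≟_ Bool._≟_)

elements : List G
elements = cartesianProduct (allFin 3) (cartesianProduct (allFin 3) (false ∷ true ∷ []))

∈-elements : ∀ g → g ∈ elements
∈-elements (x , y , s) = ∈-cartesianProduct⁺ (∈-allFin x) (∈-cartesianProduct⁺ (∈-allFin y) (∈-bool s))
  where
  ∈-bool : ∀ s → s ∈ false ∷ true ∷ []
  ∈-bool false = here refl
  ∈-bool true  = there (here refl)

open Exhaustive elements ∈-elements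

ℤ₃≀C₂ : Group 0ℓ 0ℓ
ℤ₃≀C₂ = record
  { Carrier = G ; _≈_ = _≡_ ; _∙_ = _·_ ; ε = e ; _⁻¹ = inv
  ; isGroup = record
    { isMonoid = record
      { isSemigroup = record
        { isMagma = record { isEquivalence = isEquivalence ; ∙-cong = cong₂ _·_ }
        ; assoc = from-yes (∀? λ x → ∀? λ y → ∀? λ z → ((x · y) · z) ≟ (x · (y · z))) }
      ; identity = from-yes (∀? λ x → (e · x) ≟ x) , from-yes (∀? λ x → (x · e) ≟ x) }
    ; inverse = from-yes (∀? λ x → (inv x · x) ≟ e) , from-yes (∀? λ x → (x · inv x) ≟ e)
    ; ⁻¹-cong = cong inv } }
  where
  e : G
  e = # 0 , # 0 , false

open Group ℤ₃≀C₂ using (ε)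
open GroupNotions ℤ₃≀C₂

-- 6 is the exponent of ℤ₃ ≀ C₂, so ⟨x⟩ = {xʳ : r < 6}.
FirstPowers : G → G → Set
FirstPowers x g = Σ ℕ λ r → r < 6 × g ≡ pow x r

FirstPowers? : ∀ x g → Dec (FirstPowers x g)
FirstPowers? x g = anyUpTo? (λ r → g ≟ pow x r) 6

InCyc? : ∀ x g → Dec (InCyc x g)
InCyc? x g = map′ (λ (r , _ , g≡xʳ) → + r , g≡xʳ) ⟨x⟩⊆FirstPowers (FirstPowers? x g)
  where
  ⟨x⟩⊆FirstPowers : InCyc x g → FirstPowers x g
  ⟨x⟩⊆FirstPowers = InCyc-closure ℤ₃≀C₂ (FirstPowers x) (subst (FirstPowers x)) (0 , s≤s z≤n , refl)
    (from-yes (∀? λ x → ∀? λ g → FirstPowers? x g →-dec FirstPowers? x (x · g)) x _)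
    (from-yes (∀? λ x → ∀? λ g → FirstPowers? x g →-dec FirstPowers? x (inv x · g)) x _)

CosetEq? : ∀ x g h → Dec (CosetEq x g h)
CosetEq? x g h = InCyc? x (g · inv h)

Meet? : ∀ x g y h → Dec (Meet x g y h)
Meet? x g y h = ∃? λ k → InCyc? x (k · inv g) ×-dec InCyc? y (k · inv h)

a z : G
a = # 1 , # 0 , false
z = # 0 , # 0 , true

generates : ∀ g → Gen a z g
generates (x , y , true)  = gen-≈ (a^x·z·a^y≡ x y) (Gen-∙pow ℤ₃≀C₂ (toℕ y) (gen-z (Gen-∙pow ℤ₃≀C₂ (toℕ x) gen-ε)))
  where
  a^x·z·a^y≡ : ∀ x y → ((ε · pow a (toℕ x)) · z) · pow a (toℕ y) ≡ (x , y , true)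
  a^x·z·a^y≡ = from-yes (Fin.all? λ x → Fin.all? λ y →
    (((ε · pow a (toℕ x)) · z) · pow a (toℕ y)) ≟ (x , y , true))
generates (x , y , false) = gen-≈ (a^x·z·a^y·z≡ x y) (gen-z (generates (x , y , true)))
  where
  a^x·z·a^y·z≡ : ∀ x y → (x , y , true) · z ≡ (x , y , false)
  a^x·z·a^y·z≡ = from-yes (Fin.all? λ x → Fin.all? λ y → ((x , y , true) · z) ≟ (x , y , false))

IsOrder-a : IsOrder a 3
IsOrder-a = from-yes (IsOrder? ℤ₃≀C₂ _≟_ a 3)

rotaryPair : RotaryPair a z
rotaryPair = record
  { generates = generates
  ; a-finite  = 3 , IsOrder-a
  ; z-order2  = from-yes (IsOrder? ℤ₃≀C₂ _≟_ z 2)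
  ; z∉⟨a⟩     = from-no (InCyc? a z)
  }

⟨a⟩≢⟨a⟩ᶻ : CyclicNotNormalisedBy a z
⟨a⟩≢⟨a⟩ᶻ = conj∉⟨a⟩⇒notNormalised ℤ₃≀C₂ (from-no (InCyc? a (conj a z)))

rotaInput : RotaInput
rotaInput = record
  { X = ℤ₃≀C₂ ; a = a ; z = z ; rotary = rotaryPair
  ; ordA = 3 ; isOrdA = IsOrder-a ; ordA≥3 = ≤-refl ; notNorm = ⟨a⟩≢⟨a⟩ᶻ
  ; m = 6 ; isOrdAZ = from-yes (IsOrder? ℤ₃≀C₂ _≟_ (a · z) 6)
  }

biroInput : BiRoInput
biroInput = record
  { Y = ℤ₃≀C₂ ; a = a ; z = z ; rotary = rotaryPair
  ; ordA = 3 ; isOrdA = IsOrder-a ; ordA≥3 = ≤-refl ; notNorm = ⟨a⟩≢⟨a⟩ᶻ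
  ; ℓ = 3 ; isOrdW = from-yes (IsOrder? ℤ₃≀C₂ _≟_ (z · conj z a) 3)
  }

module Rota = MapData (RotaMap rotaInput)
module BiRo = MapData (BiRoMap biroInput)

-- In the edge coordinates (u, v) this is (u, v) ↦ (u, −v), on vertices as well as on edges.
reflect : G → G
reflect (x , y , false) = x , -₃ y , false
reflect (x , y , true)  = -₃ x , y , true

-- Sends the face with u − v ∈ {d − 1, d} to the face with u + v ∈ {d − 1, d}.
reflectFace : G → G
reflectFace (x , y , false) = x +₃ # 2 , -₃ y , false
reflectFace (x , y , true)  = -₃ x , y , true

BiRoFaceEq? : Decidable BiRo._≈F_
BiRoFaceEq? g h = SeqEquiv? (CosetEq? z) (BiRo.bnd g) (BiRo.bnd h)

reflectIso : MapIso (RotaMap rotaInput) (BiRoMap biroInput)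
reflectIso = record
  { fV = reflect ; fE = reflect ; fF = reflectFace
  ; bijV = from-yes (bij? (CosetEq? a) (CosetEq? a) reflect)
  ; bijE = from-yes (bij? (CosetEq? z) (CosetEq? z) reflect)
  ; bijF = from-yes (bij? (CosetEq? (a · z)) BiRoFaceEq? reflectFace)
  ; presVE = from-yes (∀? λ v → ∀? λ e → Meet? a v z e ⇔? Meet? a (reflect v) z (reflect e))
  ; presVF = from-yes (∀? λ v → ∀? λ f →
      Meet? a v (a · z) f ⇔? Any.any? (Meet? a (reflect v) z) (BiRo.bnd (reflectFace f)))
  ; presEF = from-yes (∀? λ e → ∀? λ f →
      Meet? z e (a · z) f ⇔? Any.any? (CosetEq? z (reflect e)) (BiRo.bnd (reflectFace f)))
  ; presBnd = from-yes (∀? λ f →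
      SeqEquiv? (CosetEq? z) (map reflect (Rota.bnd f)) (BiRo.bnd (reflectFace f)))
  }

corollary1p12 : Σ RotaInput λ R → Σ BiRoInput λ B → MapIso (RotaMap R) (BiRoMap B)
corollary1p12 = rotaInput , biroInput , reflectIso
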